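{- For all integers $n \ge k \ge 1$, \[g(n,1,k) = f(n,1,k) = 2^{n-1} - \sum_{j=1}^{k-1} \binom{n-1}{j}.\]
   Context: A $1$-simplex is a pair of sets $A_1,A_2$ with $A_1 \cap A_2 = \emptyset$, $A_1 \ne \emptyset$, $A_2 \ne \emptyset$; a family is $1$-simplex-free if no two of its members form a $1$-simplex. For an $n$-element set $X$ and integer $i \ge 0$, $X^{(\le i)}$ denotes the family of subsets of $X$ of size at most $i$. For $n \ge k \ge 0$, $f(n,1,k)$ is the maximum size of a $1$-simplex-free family $\mathcal{F} \subseteq X^{(\le n-k)}$ with $|X| = n$, and $g(n,1,k)$ is the maximum size of such a family that in addition contains at least one set of size exactly $n-k$. -}

module Defs where

open import Data.Nat using (ℕ; zero; suc; _+_; _∸_; _^_; _≤_)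
open import Data.Nat.Combinatorics using (_C_)
open import Data.Fin.Subset using (Subset; _∩_; ∣_∣; Nonempty; Empty)
open import Data.List using (List; length)
open import Data.List.Membership.Propositional using (_∈_)
open import Data.List.Relation.Unary.Unique.Propositional using (Unique)
open import Data.List.Relation.Unary.All using (All)
open import Data.List.Relation.Unary.Any using (Any)
open import Data.Product using (_×_; Σ; ∃)
open import Relation.Nullary using (¬_)
open import Relation.Binary.PropositionalEquality using (_≡_)

-- The ground set X is Fin n; subsets of X are Subset n.
-- A family of subsets is a duplicate-free list of subsets; its size is its length.
record Family (n : ℕ) : Set where
  constructor family
  field
    members  : List (Subset n)
    distinct : Unique members
open Family public

size : ∀ {n} → Family n → ℕ
size F = length (members F)

IsOneSimplex : ∀ {n} → Subset n → Subset n → Set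
IsOneSimplex A₁ A₂ = Empty (A₁ ∩ A₂) × Nonempty A₁ × Nonempty A₂

OneSimplexFree : ∀ {n} → Family n → Set
OneSimplexFree F = ∀ {A B} → A ∈ members F → B ∈ members F → ¬ IsOneSimplex A B

AllOfSizeAtMost : ∀ {n} → ℕ → Family n → Set
AllOfSizeAtMost i F = All (λ A → ∣ A ∣ ≤ i) (members F)

HasMemberOfSize : ∀ {n} → ℕ → Family n → Set
HasMemberOfSize i F = Any (λ A → ∣ A ∣ ≡ i) (members F)

FAdmissible : (n k : ℕ) → Family n → Set
FAdmissible n k F = OneSimplexFree F × AllOfSizeAtMost (n ∸ k) F

GAdmissible : (n k : ℕ) → Family n → Set
GAdmissible n k F = FAdmissible n k F × HasMemberOfSize (n ∸ k) F

IsMaxSize : (n : ℕ) → (Family n → Set) → ℕ → Set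
IsMaxSize n P m = (Σ (Family n) λ F → P F × size F ≡ m)
                × (∀ F → P F → size F ≤ m)

-- Σ_{j=1}^{k-1} C(n-1, j)  (as a function of m = n-1 and k)
sumBinom : ℕ → ℕ → ℕ
sumBinom m zero = 0
sumBinom m (suc zero) = 0
sumBinom m (suc (suc j)) = sumBinom m (suc j) + m C (suc j)

formula : ℕ → ℕ → ℕ
formula n k = 2 ^ (n ∸ 1) ∸ sumBinom (n ∸ 1) k

module Submission where

-- Let n = N + 1 and m = n - k = N - (k - 1).  A 1-simplex-free family of
-- subsets of size at most m consists of (possibly) the empty set together
-- with a pairwise intersecting family of nonempty sets of size at most m.
-- The heart of the proof is an Erdős–Ko–Rado type bound ('star-bound'):
-- if m ≤ N, an intersecting family of nonempty sets of size ≤ m on N + 1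
-- points has at most 'star N m' members, the number of sets of size ≤ m
-- through a fixed point.  When 2m ≤ N it is proved by shifting sets away
-- from the point 0 until the family is stable, and then splitting it into
-- the sets avoiding 0 and those containing 0 (both again intersecting);
-- when 2m > N, the sets of size ≤ N - m are handled by the first case and
-- each larger set excludes its complement.  The star together with ∅ shows
-- the bound is attained by a family containing a set of size m, and a
-- partition of the subsets of an N-set by size identifies 1 + star N m with
-- 2^N - Σ_{j=1}^{k-1} C(N, j).  Families are represented by Boolean
-- predicates on subsets and counted by summing over all 2^N subsets.

open import Defs
open import Function using (_∘_; Equivalence)
open import Data.Empty using (⊥-elim)
open import Data.Unit using (tt)
open import Data.Nat using (ℕ; zero; suc; _+_; _*_; _∸_; _^_; _≤_; _<_; _≤ᵇ_; _<ᵇ_; _≡ᵇ_; z≤n; s≤s; z<s; _≤?_)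
open import Data.Nat.Properties
open import Data.Nat.Combinatorics using (_C_; nCk+nC[k+1]≡[n+1]C[k+1])
open import Algebra.Properties.CommutativeSemigroup +-commutativeSemigroup using (interchange)
open import Data.Bool using (Bool; true; false; not; _∧_; _∨_; if_then_else_; T)
import Data.Bool as Bool
open import Data.Bool.Properties using (∧-comm; T-∧; T-∨; T?)
open import Data.Fin using (Fin; zero; suc)
open import Data.Fin.Properties using () renaming (any? to anyPoint?)
open import Data.Vec using ([]; _∷_; lookup; here; there)
open import Data.Vec.Properties using (≡-dec; ∷-injectiveʳ)
open import Data.Fin.Subset using (Subset; ∣_∣; _∩_; ∁; Nonempty; Empty) renaming (⊥ to ∅)
open import Data.Fin.Subset.Properties using (∣p∣≤n; ∣⊥∣≡0; ∣∁p∣≡n∸∣p∣; anySubset?)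
open import Data.List using (List; []; _∷_; map; _++_; length)
open import Data.List.Properties using (length-++; length-map)
open import Data.List.Membership.Propositional using (_∈_)
open import Data.List.Membership.Propositional.Properties using (∈-map⁺; ∈-map⁻; ∈-++⁺ˡ; ∈-++⁺ʳ; ∈-++⁻)
open import Data.List.Relation.Unary.Any using (here; any?)
  renaming (map to Any-map)
open import Data.List.Relation.Unary.All as All using ()
open import Data.List.Relation.Unary.AllPairs using ([]; _∷_)
open import Data.List.Relation.Unary.Unique.Propositional using (Unique)
import Data.List.Relation.Unary.Unique.Propositional.Properties as Unique
open import Data.Product using (Σ; _×_; _,_; proj₁; proj₂; ∃; ∃₂)
open import Data.Sum using (_⊎_; inj₁; inj₂; [_,_]′)
open import Relation.Nullary using (¬_; Dec; yes; no; does; contradiction; ofʸ; ofⁿ)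
open import Relation.Nullary.Decidable using (_×-dec_; ¬?)
open import Relation.Binary.PropositionalEquality

𝟙 : Bool → ℕ
𝟙 true  = 1
𝟙 false = 0

𝟙-T : ∀ {b} → T b → 𝟙 b ≡ 1
𝟙-T {true} _ = refl

𝟙-¬T : ∀ {b} → ¬ T b → 𝟙 b ≡ 0
𝟙-¬T {false} _  = refl
𝟙-¬T {true}  ¬b = ⊥-elim (¬b tt)

𝟙-mono : ∀ {a b} → (T a → T b) → 𝟙 a ≤ 𝟙 b
𝟙-mono {false} _   = z≤n
𝟙-mono {true}  a⇒b = ≤-reflexive (sym (𝟙-T (a⇒b tt)))

𝟙-split : ∀ a c → 𝟙 a ≡ 𝟙 (a ∧ c) + 𝟙 (a ∧ not c)
𝟙-split false c     = refl
𝟙-split true  false = refl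
𝟙-split true  true  = refl

𝟙-∨∧ : ∀ a b → 𝟙 (a ∨ b) + 𝟙 (b ∧ a) ≡ 𝟙 a + 𝟙 b
𝟙-∨∧ false false = refl
𝟙-∨∧ false true  = refl
𝟙-∨∧ true  false = refl
𝟙-∨∧ true  true  = refl

∑ : ∀ {n} → (Subset n → ℕ) → ℕ
∑ {zero}  f = f []
∑ {suc n} f = ∑ (λ v → f (false ∷ v)) + ∑ (λ v → f (true ∷ v))

∑-cong : ∀ {n} {f g : Subset n → ℕ} → (∀ v → f v ≡ g v) → ∑ f ≡ ∑ g
∑-cong {zero}  f≗g = f≗g []
∑-cong {suc n} f≗g = cong₂ _+_ (∑-cong (f≗g ∘ (false ∷_))) (∑-cong (f≗g ∘ (true ∷_)))

∑-mono : ∀ {n} {f g : Subset n → ℕ} → (∀ v → f v ≤ g v) → ∑ f ≤ ∑ g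
∑-mono {zero}  f≤g = f≤g []
∑-mono {suc n} f≤g = +-mono-≤ (∑-mono (f≤g ∘ (false ∷_))) (∑-mono (f≤g ∘ (true ∷_)))

∑-mono-< : ∀ {n} {f g : Subset n → ℕ} → (∀ v → f v ≤ g v) → ∀ w → f w < g w → ∑ f < ∑ g
∑-mono-< {zero}  _   []          fw<gw = fw<gw
∑-mono-< {suc n} f≤g (false ∷ w) fw<gw =
  +-mono-<-≤ (∑-mono-< (f≤g ∘ (false ∷_)) w fw<gw) (∑-mono (f≤g ∘ (true ∷_)))
∑-mono-< {suc n} f≤g (true ∷ w)  fw<gw =
  +-mono-≤-< (∑-mono (f≤g ∘ (false ∷_))) (∑-mono-< (f≤g ∘ (true ∷_)) w fw<gw)

∑-+ : ∀ {n} (f g : Subset n → ℕ) → ∑ (λ v → f v + g v) ≡ ∑ f + ∑ g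
∑-+ {zero}  f g = refl
∑-+ {suc n} f g = trans
  (cong₂ _+_ (∑-+ (λ v → f (false ∷ v)) (λ v → g (false ∷ v))) (∑-+ (λ v → f (true ∷ v)) (λ v → g (true ∷ v))))
  (interchange (∑ (λ v → f (false ∷ v))) (∑ (λ v → g (false ∷ v))) (∑ (λ v → f (true ∷ v))) (∑ (λ v → g (true ∷ v))))

∑-const : ∀ n c → ∑ {n} (λ _ → c) ≡ 2 ^ n * c
∑-const zero    c = sym (+-identityʳ c)
∑-const (suc n) c = begin
  ∑ {n} (λ _ → c) + ∑ {n} (λ _ → c) ≡⟨ cong₂ _+_ (∑-const n c) (∑-const n c) ⟩
  2 ^ n * c + 2 ^ n * c             ≡⟨ cong (2 ^ n * c +_) (sym (+-identityʳ _)) ⟩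
  2 * (2 ^ n * c)                   ≡⟨ sym (*-assoc 2 (2 ^ n) c) ⟩
  2 ^ suc n * c                     ∎
  where open ≡-Reasoning

toggle : ∀ {n} → Fin n → Subset n → Subset n
toggle zero    (b ∷ v) = not b ∷ v
toggle (suc x) (b ∷ v) = b ∷ toggle x v

∑-toggle : ∀ {n} (x : Fin n) (f : Subset n → ℕ) → ∑ (f ∘ toggle x) ≡ ∑ f
∑-toggle zero    f = +-comm (∑ (λ v → f (true ∷ v))) (∑ (λ v → f (false ∷ v)))
∑-toggle (suc x) f = cong₂ _+_ (∑-toggle x (λ v → f (false ∷ v))) (∑-toggle x (λ v → f (true ∷ v)))

∑-∁ : ∀ {n} (f : Subset n → ℕ) → ∑ (f ∘ ∁) ≡ ∑ f
∑-∁ {zero}  f = refl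
∑-∁ {suc n} f = trans (+-comm (∑ (λ v → f (true ∷ ∁ v))) (∑ (λ v → f (false ∷ ∁ v))))
  (cong₂ _+_ (∑-∁ (λ v → f (false ∷ v))) (∑-∁ (λ v → f (true ∷ v))))

count : ∀ {n} → (Subset n → Bool) → ℕ
count φ = ∑ (𝟙 ∘ φ)

count-mono : ∀ {n} {φ ψ : Subset n → Bool} → (∀ v → T (φ v) → T (ψ v)) → count φ ≤ count ψ
count-mono φ⊆ψ = ∑-mono (λ v → 𝟙-mono (φ⊆ψ v))

count-none : ∀ {n} (φ : Subset n → Bool) → (∀ v → ¬ T (φ v)) → count φ ≡ 0
count-none {n} φ none = trans (∑-cong (𝟙-¬T ∘ none)) (trans (∑-const n 0) (*-zeroʳ (2 ^ n)))

count-split : ∀ {n} (φ c : Subset n → Bool) →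
  count φ ≡ count (λ v → φ v ∧ c v) + count (λ v → φ v ∧ not (c v))
count-split φ c =
  trans (∑-cong (λ v → 𝟙-split (φ v) (c v))) (∑-+ (λ v → 𝟙 (φ v ∧ c v)) (λ v → 𝟙 (φ v ∧ not (c v))))

meets : ∀ {n} → Subset n → Subset n → Bool
meets []      []      = false
meets (a ∷ u) (b ∷ w) = (a ∧ b) ∨ meets u w

nonemptyᵇ : ∀ {n} → Subset n → Bool
nonemptyᵇ []      = false
nonemptyᵇ (a ∷ v) = a ∨ nonemptyᵇ v

isEmpty : ∀ {n} → Subset n → Bool
isEmpty v = not (nonemptyᵇ v)

isEmpty-size : ∀ {n} (v : Subset n) → T (isEmpty v) → ∣ v ∣ ≡ 0
isEmpty-size []          _ = refl
isEmpty-size (false ∷ v) t = isEmpty-size v t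

isEmpty-∅ : ∀ n → T (isEmpty (∅ {n}))
isEmpty-∅ zero    = tt
isEmpty-∅ (suc n) = isEmpty-∅ n

count-empty : ∀ n → count {n} isEmpty ≡ 1
count-empty zero    = refl
count-empty (suc n) = cong₂ _+_ (count-empty n) (count-none {n} (λ v → isEmpty (true ∷ v)) (λ v ()))

toggle-involutive : ∀ {n} (x : Fin n) v → toggle x (toggle x v) ≡ v
toggle-involutive zero    (false ∷ v) = refl
toggle-involutive zero    (true  ∷ v) = refl
toggle-involutive (suc x) (b ∷ v)     = cong (b ∷_) (toggle-involutive x v)

lookup-toggle : ∀ {n} (x : Fin n) v → lookup (toggle x v) x ≡ not (lookup v x)
lookup-toggle zero    (b ∷ v) = refl
lookup-toggle (suc x) (b ∷ v) = lookup-toggle x v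

size-toggle : ∀ {n} (x : Fin n) v → lookup v x ≡ true → suc ∣ toggle x v ∣ ≡ ∣ v ∣
size-toggle zero    (true  ∷ v) refl = refl
size-toggle (suc x) (false ∷ v) x∈v  = size-toggle x v x∈v
size-toggle (suc x) (true  ∷ v) x∈v  = cong suc (size-toggle x v x∈v)

size-∁ : ∀ {n} (v : Subset n) → ∣ v ∣ + ∣ ∁ v ∣ ≡ n
size-∁ v = trans (cong (∣ v ∣ +_) (∣∁p∣≡n∸∣p∣ v)) (m+[n∸m]≡n (∣p∣≤n v))

meets-sym : ∀ {n} (u w : Subset n) → T (meets u w) → T (meets w u)
meets-sym u w = subst T (meets-comm u w)
  where
  meets-comm : ∀ {n} (u w : Subset n) → meets u w ≡ meets w u
  meets-comm []      []      = refl
  meets-comm (a ∷ u) (b ∷ w) = cong₂ _∨_ (∧-comm a b) (meets-comm u w)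

meets-toggleˡ : ∀ {n} (x : Fin n) u w → lookup w x ≡ false → meets (toggle x u) w ≡ meets u w
meets-toggleˡ zero    (false ∷ u) (false ∷ w) _   = refl
meets-toggleˡ zero    (true  ∷ u) (false ∷ w) _   = refl
meets-toggleˡ (suc x) (a ∷ u)     (b ∷ w)     x∉w = cong ((a ∧ b) ∨_) (meets-toggleˡ x u w x∉w)

meets-toggleʳ : ∀ {n} (x : Fin n) u w → lookup u x ≡ false → meets u (toggle x w) ≡ meets u w
meets-toggleʳ zero    (false ∷ u) (b ∷ w) _   = refl
meets-toggleʳ (suc x) (a ∷ u)     (b ∷ w) x∉u = cong ((a ∧ b) ∨_) (meets-toggleʳ x u w x∉u)

meets-at : ∀ {n} (x : Fin n) u w → lookup u x ≡ true → lookup w x ≡ true → T (meets u w)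
meets-at zero    (true ∷ u) (true ∷ w) refl refl = tt
meets-at (suc x) (a ∷ u)    (b ∷ w)    x∈u  x∈w  =
  Equivalence.from T-∨ (inj₂ (meets-at x u w x∈u x∈w))

meets-∅ : ∀ {n} (v : Subset n) → ¬ T (meets v ∅)
meets-∅ (false ∷ v) = meets-∅ v
meets-∅ (true  ∷ v) = meets-∅ v

meets-∁ : ∀ {n} (v : Subset n) → ¬ T (meets v (∁ v))
meets-∁ (false ∷ v) = meets-∁ v
meets-∁ (true  ∷ v) = meets-∁ v

nonemptyᵇ-at : ∀ {n} (x : Fin n) v → lookup v x ≡ true → T (nonemptyᵇ v)
nonemptyᵇ-at zero    (true ∷ v) refl = tt
nonemptyᵇ-at (suc x) (b ∷ v)    x∈v  =
  Equivalence.from T-∨ (inj₂ (nonemptyᵇ-at x v x∈v))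

¬nonemptyᵇ⇒∅ : ∀ {n} (v : Subset n) → ¬ T (nonemptyᵇ v) → v ≡ ∅
¬nonemptyᵇ⇒∅ []          _  = refl
¬nonemptyᵇ⇒∅ (false ∷ v) ¬t = cong (false ∷_) (¬nonemptyᵇ⇒∅ v ¬t)
¬nonemptyᵇ⇒∅ (true  ∷ v) ¬t = ⊥-elim (¬t tt)

free-point : ∀ {n} (u w : Subset n) → ∣ u ∣ + ∣ w ∣ < n →
  ∃ λ x → lookup u x ≡ false × lookup w x ≡ false
free-point (false ∷ u) (false ∷ w) _ = zero , refl , refl
free-point {suc n} (false ∷ u) (true  ∷ w) small
  with free-point u w (≤-pred (subst (_< suc n) (+-suc ∣ u ∣ ∣ w ∣) small))
... | x , x∉u , x∉w = suc x , x∉u , x∉w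
free-point (true  ∷ u) (false ∷ w) small
  with free-point u w (≤-pred small)
... | x , x∉u , x∉w = suc x , x∉u , x∉w
free-point {suc n} (true  ∷ u) (true  ∷ w) small
  with free-point u w (<⇒≤ (subst (_< n) (+-suc ∣ u ∣ ∣ w ∣) (≤-pred small)))
... | x , x∉u , x∉w = suc x , x∉u , x∉w

Bounded : ∀ {n} → ℕ → (Subset n → Bool) → Set
Bounded m φ = ∀ v → T (φ v) → T (nonemptyᵇ v) × ∣ v ∣ ≤ m

Intersecting : ∀ {n} → (Subset n → Bool) → Set
Intersecting φ = ∀ u w → T (φ u) → T (φ w) → T (meets u w)

intersecting-⊆ : ∀ {n} {φ ψ : Subset n → Bool} → Intersecting φ → (∀ v → T (ψ v) → T (φ v)) → Intersecting ψ
intersecting-⊆ int ψ⊆φ u w tu tw = int u w (ψ⊆φ u tu) (ψ⊆φ w tw)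

-- The members avoiding the point 0, and those containing it (with 0 removed).
-- By definition count φ ≡ count (avoiding₀ φ) + count (through₀ φ).
avoiding₀ through₀ : ∀ {n} → (Subset (suc n) → Bool) → Subset n → Bool
avoiding₀ φ v = φ (false ∷ v)
through₀  φ v = φ (true ∷ v)

-- The number of sets of size at most m through a fixed point of an
-- (n+1)-set.  By definition it satisfies Pascal's rule
-- star (suc n) (suc m) ≡ star n (suc m) + star n m.
star : ℕ → ℕ → ℕ
star n m = count {n} (λ v → suc ∣ v ∣ ≤ᵇ m)

StarBound : ℕ → ℕ → Set
StarBound n m = ∀ (φ : Subset (suc n) → Bool) → Bounded m φ → Intersecting φ → count φ ≤ star n m

nonempty-size : ∀ {n} (v : Subset n) → T (nonemptyᵇ v) → 0 < ∣ v ∣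
nonempty-size (false ∷ v) t = nonempty-size v t
nonempty-size (true  ∷ v) _ = z<s

star-bound-0 : ∀ n → StarBound n 0
star-bound-0 n φ bnd _ = ≤-trans (≤-reflexive (count-none φ empty)) z≤n
  where
  empty : ∀ v → ¬ T (φ v)
  empty v p = <⇒≱ (nonempty-size v (proj₁ (bnd v p))) (proj₂ (bnd v p))

centred-bound : ∀ {n m} (φ : Subset (suc n) → Bool) →
  (∀ v → ¬ T (φ (false ∷ v))) → Bounded m φ → count φ ≤ star n m
centred-bound {n} {m} φ avoids bnd = begin
  count φ            ≡⟨ cong (_+ count (through₀ φ)) (count-none (avoiding₀ φ) avoids) ⟩
  count (through₀ φ) ≤⟨ count-mono (λ v p → ≤⇒≤ᵇ (proj₂ (bnd (true ∷ v) p))) ⟩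
  star n m           ∎
  where open ≤-Reasoning

-- Shifting.

-- Stability: replacing 0 by a new point x in a member yields a member.
Stable : ∀ {n} → (Subset (suc n) → Bool) → Set
Stable ψ = ∀ x v → T (ψ (true ∷ v)) → lookup v x ≡ false → T (ψ (false ∷ toggle x v))

-- The shift from 0 to x: a member A with 0 ∈ A and x ∉ A is replaced by
-- A - 0 + x, unless that set is already a member.
shift : ∀ {n} → Fin n → (Subset (suc n) → Bool) → Subset (suc n) → Bool
shift x φ (true  ∷ v) = if lookup v x then φ (true ∷ v) else (φ (true ∷ v) ∧ φ (false ∷ toggle x v))
shift x φ (false ∷ v) = if lookup v x then (φ (false ∷ v) ∨ φ (true ∷ toggle x v)) else φ (false ∷ v)

∑-pairing : ∀ {n} (x : Fin n) (f : Subset (suc n) → ℕ) →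
  ∑ f ≡ ∑ (λ v → f (false ∷ v) + f (true ∷ toggle x v))
∑-pairing x f = trans
  (cong (∑ (λ v → f (false ∷ v)) +_) (sym (∑-toggle x (λ v → f (true ∷ v)))))
  (sym (∑-+ (λ v → f (false ∷ v)) (λ v → f (true ∷ toggle x v))))

-- On each such pair the shift only moves members around.
shift-pair : ∀ {n} (x : Fin n) φ v →
  𝟙 (shift x φ (false ∷ v)) + 𝟙 (shift x φ (true ∷ toggle x v)) ≡ 𝟙 (φ (false ∷ v)) + 𝟙 (φ (true ∷ toggle x v))
shift-pair x φ v with lookup v x in x∈?v
... | true  rewrite lookup-toggle x v | x∈?v | toggle-involutive x v = 𝟙-∨∧ (φ (false ∷ v)) (φ (true ∷ toggle x v))
... | false rewrite lookup-toggle x v | x∈?v = refl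

count-shift : ∀ {n} (x : Fin n) φ → count (shift x φ) ≡ count φ
count-shift x φ = begin
  count (shift x φ)                                             ≡⟨ ∑-pairing x (𝟙 ∘ shift x φ) ⟩
  ∑ (λ v → 𝟙 (shift x φ (false ∷ v)) + 𝟙 (shift x φ (true ∷ toggle x v))) ≡⟨ ∑-cong (shift-pair x φ) ⟩
  ∑ (λ v → 𝟙 (φ (false ∷ v)) + 𝟙 (φ (true ∷ toggle x v)))       ≡⟨ ∑-pairing x (𝟙 ∘ φ) ⟨
  count φ                                                       ∎
  where open ≡-Reasoning

data ShiftedMember {n} (x : Fin n) (φ : Subset (suc n) → Bool) : Subset (suc n) → Set where
  kept₁ : ∀ v → T (φ (true ∷ v)) → (lookup v x ≡ false → T (φ (false ∷ toggle x v))) →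
          ShiftedMember x φ (true ∷ v)
  kept₀ : ∀ v → T (φ (false ∷ v)) → ShiftedMember x φ (false ∷ v)
  moved : ∀ v → lookup v x ≡ true → T (φ (true ∷ toggle x v)) → ShiftedMember x φ (false ∷ v)

classify : ∀ {n} (x : Fin n) φ A → T (shift x φ A) → ShiftedMember x φ A
classify x φ (true ∷ v) t with lookup v x in x∈?v
... | true  = kept₁ v t (λ x∉v → contradiction (trans (sym x∈?v) x∉v) λ ())
... | false = kept₁ v (proj₁ (Equivalence.to T-∧ t)) (λ _ → proj₂ (Equivalence.to T-∧ t))
classify x φ (false ∷ v) t with lookup v x in x∈?v
... | false = kept₀ v t
... | true with φ (false ∷ v) in kept
...   | true  = kept₀ v (subst T (sym kept) tt)
...   | false = moved v x∈?v t

moved-meets : ∀ {n} (x : Fin n) φ → Intersecting φ → ∀ v B →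
  lookup v x ≡ true → T (φ (true ∷ toggle x v)) → ShiftedMember x φ B → T (meets (false ∷ v) B)
moved-meets x φ int v .(true ∷ w) x∈v pv (kept₁ w pw kw) with lookup w x in x∈?w
... | true  = meets-at x v w x∈v x∈?w
... | false = subst T (trans (meets-toggleʳ x (toggle x v) w x∉v') (meets-toggleˡ x v w x∈?w))
                      (int (true ∷ toggle x v) (false ∷ toggle x w) pv (kw refl))
  where
  x∉v' : lookup (toggle x v) x ≡ false
  x∉v' = trans (lookup-toggle x v) (cong not x∈v)
moved-meets x φ int v .(false ∷ w) x∈v pv (kept₀ w pw) with lookup w x in x∈?w
... | true  = meets-at x v w x∈v x∈?w
... | false = subst T (meets-toggleˡ x v w x∈?w) (int (true ∷ toggle x v) (false ∷ w) pv pw)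
moved-meets x φ int v .(false ∷ w) x∈v pv (moved w x∈w pw) = meets-at x v w x∈v x∈w

shift-intersecting : ∀ {n} (x : Fin n) φ → Intersecting φ → Intersecting (shift x φ)
shift-intersecting x φ int A B tA tB = meet (classify x φ A tA) (classify x φ B tB)
  where
  meet : ∀ {A B} → ShiftedMember x φ A → ShiftedMember x φ B → T (meets A B)
  meet (moved v x∈v pv) cB                 = moved-meets x φ int v _ x∈v pv cB
  meet {A} cA (moved v x∈v pv)             = meets-sym (false ∷ v) A (moved-meets x φ int v _ x∈v pv cA)
  meet (kept₁ u pu _) (kept₁ w pw _)       = int _ _ pu pw
  meet (kept₁ u pu _) (kept₀ w pw)         = int _ _ pu pw
  meet (kept₀ u pu)   (kept₁ w pw _)       = int _ _ pu pw
  meet (kept₀ u pu)   (kept₀ w pw)         = int _ _ pu pw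

-- A moved set has the same size as the set it replaces.
shift-bounded : ∀ {n m} (x : Fin n) φ → Bounded m φ → Bounded m (shift x φ)
shift-bounded {m = m} x φ bnd A t with classify x φ A t
... | kept₁ v pv _   = bnd _ pv
... | kept₀ v pv     = bnd _ pv
... | moved v x∈v pv = nonemptyᵇ-at x v x∈v , subst (_≤ m) (size-toggle x v x∈v) (proj₂ (bnd _ pv))

-- A shift never adds sets containing 0, and it removes one whenever φ is not
-- stable at (x, v).
shift-decreases : ∀ {n} (x : Fin n) φ v → T (φ (true ∷ v)) → lookup v x ≡ false →
  ¬ T (φ (false ∷ toggle x v)) → count (through₀ (shift x φ)) < count (through₀ φ)
shift-decreases x φ v pv x∉v ¬moved = ∑-mono-< (λ w → 𝟙-mono (kept w)) v
  (subst₂ _<_ (sym (𝟙-¬T removed)) (sym (𝟙-T pv)) z<s)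
  where
  kept : ∀ w → T (shift x φ (true ∷ w)) → T (φ (true ∷ w))
  kept w t with classify x φ (true ∷ w) t
  ... | kept₁ _ pw _ = pw
  removed : ¬ T (shift x φ (true ∷ v))
  removed t with classify x φ (true ∷ v) t
  ... | kept₁ _ _ kv = ¬moved (kv x∉v)

stable? : ∀ {n} (φ : Subset (suc n) → Bool) →
  Stable φ ⊎ ∃₂ λ x v → T (φ (true ∷ v)) × lookup v x ≡ false × ¬ T (φ (false ∷ toggle x v))
stable? φ with anyPoint? (λ x → anySubset? (λ v →
  T? (φ (true ∷ v)) ×-dec (lookup v x Bool.≟ false) ×-dec ¬? (T? (φ (false ∷ toggle x v)))))
... | yes (x , v , unstable) = inj₂ (x , v , unstable)
... | no  none               = inj₁ stable
  where
  stable : Stable φ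
  stable x v pv x∉v with T? (φ (false ∷ toggle x v))
  ... | yes member = member
  ... | no  ¬moved = ⊥-elim (none (x , v , pv , x∉v , ¬moved))

stabilise : ∀ {n m} c (φ : Subset (suc n) → Bool) → count (through₀ φ) ≤ c →
  Bounded m φ → Intersecting φ →
  ∃ λ ψ → count ψ ≡ count φ × Bounded m ψ × Intersecting ψ × Stable ψ
stabilise c φ fuel bnd int with stable? φ
... | inj₁ stable = φ , refl , bnd , int , stable
stabilise zero    φ fuel bnd int | inj₂ (x , v , pv , x∉v , ¬moved) =
  ⊥-elim (n≮0 (≤-trans (shift-decreases x φ v pv x∉v ¬moved) fuel))
stabilise (suc c) φ fuel bnd int | inj₂ (x , v , pv , x∉v , ¬moved)
  with stabilise c (shift x φ) (≤-pred (≤-trans (shift-decreases x φ v pv x∉v ¬moved) fuel))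
         (shift-bounded x φ bnd) (shift-intersecting x φ int)
... | ψ , same , rest = ψ , trans same (count-shift x φ) , rest

-- A stable family containing {0} lies in the star.
-- Otherwise its sets avoiding 0 form an intersecting family of sets of size
-- ≤ m + 1, and its sets containing 0 (with 0 removed) one of sets of size
-- ≤ m: were two of the latter, u and w, disjoint, they would leave a point z
-- free, and by stability u + z would be a member disjoint from w + 0.
stable-bound : ∀ {n m} → m + m ≤ n → StarBound n (suc m) → StarBound n m →
  (ψ : Subset (suc (suc n)) → Bool) → Bounded (suc m) ψ → Intersecting ψ → Stable ψ →
  count ψ ≤ star (suc n) (suc m)
stable-bound {n} {m} 2m≤n IH₁ IH₀ ψ bnd int stable with T? (ψ (true ∷ ∅))
... | yes single∈ψ = centred-bound ψ (λ v p → meets-∅ v (int (false ∷ v) (true ∷ ∅) p single∈ψ)) bnd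
... | no  single∉ψ = +-mono-≤
  (IH₁ (avoiding₀ ψ) (λ v → bnd (false ∷ v)) (λ u w → int (false ∷ u) (false ∷ w)))
  (IH₀ (through₀ ψ) bounded intersecting)
  where
  bounded : Bounded m (through₀ ψ)
  bounded v p = nonempty , ≤-pred (proj₂ (bnd (true ∷ v) p))
    where
    nonempty : T (nonemptyᵇ v)
    nonempty with T? (nonemptyᵇ v)
    ... | yes ne  = ne
    ... | no  ¬ne = ⊥-elim (single∉ψ (subst (λ z → T (ψ (true ∷ z))) (¬nonemptyᵇ⇒∅ v ¬ne) p))
  intersecting : Intersecting (through₀ ψ)
  intersecting u w pu pw with T? (meets u w)
  ... | yes uw  = uw
  ... | no  ¬uw with free-point u w (s≤s (≤-trans (+-mono-≤ (proj₂ (bounded u pu)) (proj₂ (bounded w pw))) 2m≤n))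
  ...   | z , z∉u , z∉w = ⊥-elim (¬uw (subst T (meets-toggleˡ z u w z∉w)
          (int (false ∷ toggle z u) (true ∷ w) (stable z u pu z∉u) pw)))

shifting-step : ∀ {n m} → m + m ≤ n → StarBound n (suc m) → StarBound n m → StarBound (suc n) (suc m)
shifting-step {n} {m} 2m≤n IH₁ IH₀ φ bnd int with stabilise (count (through₀ φ)) φ ≤-refl bnd int
... | ψ , same , bndψ , intψ , stable = subst (_≤ star (suc n) (suc m)) same (stable-bound 2m≤n IH₁ IH₀ ψ bndψ intψ stable)

-- The unbalanced case.

inRange : ℕ → ℕ → ℕ → Bool
inRange s m a = not (a ≤ᵇ s) ∧ (a ≤ᵇ m)

-- Introduction and elimination for 'inRange', stated with the definition
-- unfolded so that the case split on a ≤ᵇ s can rewrite it.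
inRange-intro : ∀ {s m a} → s < a → a ≤ m → T (not (a ≤ᵇ s) ∧ (a ≤ᵇ m))
inRange-intro {s} {m} {a} s<a a≤m with a ≤ᵇ s | ≤ᵇ-reflects-≤ a s
... | true  | ofʸ a≤s = <⇒≱ s<a a≤s
... | false | _       = ≤⇒≤ᵇ a≤m

inRange-elim : ∀ {s m} a → T (not (a ≤ᵇ s) ∧ (a ≤ᵇ m)) → s < a × a ≤ m
inRange-elim {s} {m} a t with a ≤ᵇ s | ≤ᵇ-reflects-≤ a s
... | false | ofⁿ a≰s = ≰⇒> a≰s , ≤ᵇ⇒≤ a m t

≤ᵇ-split : ∀ {s m} b → s ≤ m → 𝟙 (b ≤ᵇ m) ≡ 𝟙 (b ≤ᵇ s) + 𝟙 (not (b ≤ᵇ s) ∧ (b ≤ᵇ m))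
≤ᵇ-split {s} b s≤m with b ≤ᵇ s | ≤ᵇ-reflects-≤ b s
... | true  | ofʸ b≤s = 𝟙-T (≤⇒≤ᵇ (≤-trans b≤s s≤m))
... | false | _       = refl

range-complement : ∀ {s m a b} → a + b ≡ m + suc s → s < a → a ≤ m → s < b × b ≤ m
range-complement {s} {m} {a} {b} eq s<a a≤m =
    +-cancelˡ-≤ m (suc s) b (subst (_≤ m + b) eq (+-monoˡ-≤ b a≤m))
  , +-cancelˡ-≤ a b m (subst (_≤ a + m) (sym eq) (subst (m + suc s ≤_) (+-comm m a) (+-monoʳ-≤ m s<a)))

∑-pairing-∁ : ∀ {n} (f : Subset (suc n) → ℕ) → ∑ f ≡ ∑ (λ v → f (false ∷ v) + f (true ∷ ∁ v))
∑-pairing-∁ f = trans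
  (cong (∑ (λ v → f (false ∷ v)) +_) (sym (∑-∁ (λ v → f (true ∷ v)))))
  (sym (∑-+ (λ v → f (false ∷ v)) (λ v → f (true ∷ ∁ v))))

𝟙-∨-disjoint : ∀ {a b} → ¬ (T a × T b) → 𝟙 (a ∨ b) ≡ 𝟙 a + 𝟙 b
𝟙-∨-disjoint {false}         _     = refl
𝟙-∨-disjoint {true} {false}  _     = refl
𝟙-∨-disjoint {true} {true}   ¬both = ⊥-elim (¬both (tt , tt))

-- An intersecting family inside a complement-closed family μ contains at
-- most one set of each complementary pair, hence at most as many sets as μ
-- has through the point 0.
half-bound : ∀ {n} (φ μ : Subset (suc n) → Bool) → Intersecting φ →
  (∀ v → T (φ v) → T (μ v)) → (∀ v → T (μ v) → T (μ (∁ v))) → count φ ≤ count (through₀ μ)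
half-bound φ μ int φ⊆μ closed = begin
  count φ                                            ≡⟨ ∑-pairing-∁ (𝟙 ∘ φ) ⟩
  ∑ (λ v → 𝟙 (φ (false ∷ v)) + 𝟙 (φ (true ∷ ∁ v))) ≤⟨ ∑-mono pair ⟩
  ∑ (λ v → 𝟙 (μ (true ∷ ∁ v)))                      ≡⟨ ∑-∁ (𝟙 ∘ through₀ μ) ⟩
  count (through₀ μ)                                 ∎
  where
  open ≤-Reasoning
  pair : ∀ v → 𝟙 (φ (false ∷ v)) + 𝟙 (φ (true ∷ ∁ v)) ≤ 𝟙 (μ (true ∷ ∁ v))
  pair v = begin
    𝟙 (φ (false ∷ v)) + 𝟙 (φ (true ∷ ∁ v)) ≡⟨ 𝟙-∨-disjoint (λ (p , q) → meets-∁ (false ∷ v) (int _ _ p q)) ⟨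
    𝟙 (φ (false ∷ v) ∨ φ (true ∷ ∁ v))     ≤⟨ 𝟙-mono (λ t → [ closed _ ∘ φ⊆μ _ , φ⊆μ _ ]′ (Equivalence.to T-∨ t)) ⟩
    𝟙 (μ (true ∷ ∁ v))                     ∎

-- For n < 2m, with s = n - m: the members of size ≤ s are bounded by the
-- balanced case, those of size in (s, m] by 'half-bound'.
complement-step : ∀ {n m} → m ≤ n → n ∸ m ≤ m → StarBound n (n ∸ m) → StarBound n m
complement-step {n} {m} m≤n s≤m IH φ bnd int = begin
  count φ                         ≡⟨ count-split φ small ⟩
  count φ≤s + count φ>s           ≤⟨ +-mono-≤ (IH φ≤s bnd≤s (intersecting-⊆ int (λ v → proj₁ ∘ Equivalence.to T-∧)))
                                               (half-bound φ>s μ (intersecting-⊆ int (λ v → proj₁ ∘ Equivalence.to T-∧)) φ>s⊆μ μ-closed) ⟩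
  star n s + count (through₀ μ)   ≡⟨ star-split ⟨
  star n m                        ∎
  where
  open ≤-Reasoning
  s = n ∸ m
  small : Subset (suc n) → Bool
  small v = ∣ v ∣ ≤ᵇ s
  φ≤s φ>s μ : Subset (suc n) → Bool
  φ≤s v = φ v ∧ small v
  φ>s v = φ v ∧ not (small v)
  μ   v = inRange s m ∣ v ∣
  bnd≤s : Bounded s φ≤s
  bnd≤s v t = proj₁ (bnd v (proj₁ (Equivalence.to T-∧ t))) , ≤ᵇ⇒≤ _ _ (proj₂ (Equivalence.to T-∧ t))
  φ>s⊆μ : ∀ v → T (φ>s v) → T (μ v)
  φ>s⊆μ v t = Equivalence.from T-∧ (proj₂ (Equivalence.to T-∧ t) , ≤⇒≤ᵇ (proj₂ (bnd v (proj₁ (Equivalence.to T-∧ t)))))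
  μ-closed : ∀ v → T (μ v) → T (μ (∁ v))
  μ-closed v t = let (s<a , a≤m) = inRange-elim ∣ v ∣ t
                     (s<b , b≤m) = range-complement size-sum s<a a≤m
                 in inRange-intro s<b b≤m
    where
    size-sum : ∣ v ∣ + ∣ ∁ v ∣ ≡ m + suc s
    size-sum = trans (size-∁ v) (trans (cong suc (sym (m+[n∸m]≡n m≤n))) (sym (+-suc m s)))
  star-split : star n m ≡ star n s + count (through₀ μ)
  star-split = trans (∑-cong {n} (λ v → ≤ᵇ-split (suc ∣ v ∣) s≤m))
                     (∑-+ {n} (λ v → 𝟙 (suc ∣ v ∣ ≤ᵇ s)) (𝟙 ∘ through₀ μ))

star-bound         : ∀ n m → m ≤ n → StarBound n m
balanced-star-bound : ∀ n m → m + m ≤ n → StarBound n m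

star-bound n m m≤n with m + m ≤? n
... | yes 2m≤n = balanced-star-bound n m 2m≤n
... | no  2m≰n = complement-step m≤n s≤m (balanced-star-bound n (n ∸ m) 2s≤n)
  where
  s≤m : n ∸ m ≤ m
  s≤m = subst (n ∸ m ≤_) (m+n∸m≡n m m) (∸-monoˡ-≤ m (<⇒≤ (≰⇒> 2m≰n)))
  2s≤n : (n ∸ m) + (n ∸ m) ≤ n
  2s≤n = subst ((n ∸ m) + (n ∸ m) ≤_) (m∸n+n≡m m≤n) (+-monoʳ-≤ (n ∸ m) s≤m)

balanced-star-bound n       zero    _    = star-bound-0 n
balanced-star-bound (suc n) (suc m) 2m≤n = shifting-step
  (≤-trans (+-monoʳ-≤ m (n≤1+n m)) m+m<n)
  (star-bound n (suc m) (m+n≤o⇒n≤o m m+m<n))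
  (star-bound n m (≤-trans (n≤1+n m) (m+n≤o⇒n≤o m m+m<n)))
  where
  m+m<n : m + suc m ≤ n
  m+m<n = ≤-pred 2m≤n

-- From lists of sets to Boolean predicates and back.

_≟ˢ_ : ∀ {n} (u v : Subset n) → Dec (u ≡ v)
_≟ˢ_ = ≡-dec Bool._≟_

_∈ᵇ_ : ∀ {n} → Subset n → List (Subset n) → Bool
v ∈ᵇ xs = does (any? (v ≟ˢ_) xs)

witness : ∀ {P : Set} (d : Dec P) → T (does d) → P
witness (yes p) _ = p
witness (no _)  ()

∈ᵇ⇒∈ : ∀ {n} {v : Subset n} xs → T (v ∈ᵇ xs) → v ∈ xs
∈ᵇ⇒∈ {v = v} xs = witness (any? (v ≟ˢ_) xs)

count-singleton : ∀ {n} (x : Subset n) → count (λ v → does (v ≟ˢ x)) ≡ 1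
count-singleton []          = refl
count-singleton (false ∷ x) =
  cong₂ _+_ (count-singleton x) (count-none (λ v → does ((true ∷ v) ≟ˢ (false ∷ x))) (λ v ()))
count-singleton (true  ∷ x) =
  cong₂ _+_ (count-none (λ v → does ((false ∷ v) ≟ˢ (true ∷ x))) (λ v ())) (count-singleton x)

length-≤-count : ∀ {n} (xs : List (Subset n)) → Unique xs → length xs ≤ count (_∈ᵇ xs)
length-≤-count []       []             = z≤n
length-≤-count (x ∷ xs) (x∉xs ∷ unique) = begin
  suc (length xs)                           ≡⟨ cong (_+ length xs) (count-singleton x) ⟨
  count (λ v → does (v ≟ˢ x)) + length xs    ≤⟨ +-monoʳ-≤ _ (length-≤-count xs unique) ⟩
  count (λ v → does (v ≟ˢ x)) + count (_∈ᵇ xs) ≡⟨ ∑-+ (λ v → 𝟙 (does (v ≟ˢ x))) (λ v → 𝟙 (v ∈ᵇ xs)) ⟨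
  ∑ (λ v → 𝟙 (does (v ≟ˢ x)) + 𝟙 (v ∈ᵇ xs))  ≡⟨ ∑-cong (λ v → 𝟙-∨-disjoint (new v)) ⟨
  count (_∈ᵇ (x ∷ xs))                      ∎
  where
  open ≤-Reasoning
  new : ∀ v → ¬ (T (does (v ≟ˢ x)) × T (v ∈ᵇ xs))
  new v (v≡x , v∈xs) with witness (v ≟ˢ x) v≡x
  ... | refl = All.lookup x∉xs (∈ᵇ⇒∈ xs v∈xs) refl

enumerate : ∀ {n} → (Subset n → Bool) → List (Subset n)
enumerate {zero}  φ = if φ [] then [] ∷ [] else []
enumerate {suc n} φ = map (false ∷_) (enumerate (avoiding₀ φ)) ++ map (true ∷_) (enumerate (through₀ φ))

length-enumerate : ∀ {n} (φ : Subset n → Bool) → length (enumerate φ) ≡ count φ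
length-enumerate {zero}  φ with φ []
... | true  = refl
... | false = refl
length-enumerate {suc n} φ = begin
  length (map (false ∷_) xs₀ ++ map (true ∷_) xs₁)        ≡⟨ length-++ (map (false ∷_) xs₀) ⟩
  length (map (false ∷_) xs₀) + length (map (true ∷_) xs₁) ≡⟨ cong₂ _+_ (length-map (false ∷_) xs₀) (length-map (true ∷_) xs₁) ⟩
  length xs₀ + length xs₁                                  ≡⟨ cong₂ _+_ (length-enumerate (avoiding₀ φ)) (length-enumerate (through₀ φ)) ⟩
  count φ                                                  ∎
  where
  open ≡-Reasoning
  xs₀ = enumerate (avoiding₀ φ)
  xs₁ = enumerate (through₀ φ)

enumerate-sound : ∀ {n} (φ : Subset n → Bool) {v} → v ∈ enumerate φ → T (φ v)
enumerate-sound {zero}  φ {[]} v∈ with φ []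
... | true = tt
enumerate-sound {suc n} φ v∈ with ∈-++⁻ (map (false ∷_) (enumerate (avoiding₀ φ))) v∈
... | inj₁ v∈₀ with ∈-map⁻ (false ∷_) v∈₀
...   | w , w∈ , refl = enumerate-sound (avoiding₀ φ) w∈
enumerate-sound {suc n} φ v∈ | inj₂ v∈₁ with ∈-map⁻ (true ∷_) v∈₁
...   | w , w∈ , refl = enumerate-sound (through₀ φ) w∈

enumerate-complete : ∀ {n} (φ : Subset n → Bool) v → T (φ v) → v ∈ enumerate φ
enumerate-complete {zero}  φ [] t with φ []
... | true = here refl
enumerate-complete {suc n} φ (false ∷ v) t =
  ∈-++⁺ˡ (∈-map⁺ (false ∷_) (enumerate-complete (avoiding₀ φ) v t))
enumerate-complete {suc n} φ (true  ∷ v) t =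
  ∈-++⁺ʳ (map (false ∷_) (enumerate (avoiding₀ φ))) (∈-map⁺ (true ∷_) (enumerate-complete (through₀ φ) v t))

enumerate-unique : ∀ {n} (φ : Subset n → Bool) → Unique (enumerate φ)
enumerate-unique {zero}  φ with φ []
... | true  = All.[] ∷ []
... | false = []
enumerate-unique {suc n} φ = Unique.++⁺
  (Unique.map⁺ ∷-injectiveʳ (enumerate-unique (avoiding₀ φ)))
  (Unique.map⁺ ∷-injectiveʳ (enumerate-unique (through₀ φ)))
  different-heads
  where
  different-heads : ∀ {v} → ¬ (v ∈ map (false ∷_) (enumerate (avoiding₀ φ)) × v ∈ map (true ∷_) (enumerate (through₀ φ)))
  different-heads (v∈₀ , v∈₁) with ∈-map⁻ (false ∷_) v∈₀ | ∈-map⁻ (true ∷_) v∈₁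
  ... | _ , _ , refl | _ , _ , ()

disjoint⇒Empty : ∀ {n} (u w : Subset n) → ¬ T (meets u w) → Empty (u ∩ w)
disjoint⇒Empty (true  ∷ u) (true  ∷ w) ¬uw _                   = ¬uw tt
disjoint⇒Empty (false ∷ u) (b     ∷ w) ¬uw (suc x , there x∈) = disjoint⇒Empty u w ¬uw (x , x∈)
disjoint⇒Empty (true  ∷ u) (false ∷ w) ¬uw (suc x , there x∈) = disjoint⇒Empty u w ¬uw (x , x∈)

nonemptyᵇ⇒Nonempty : ∀ {n} (v : Subset n) → T (nonemptyᵇ v) → Nonempty v
nonemptyᵇ⇒Nonempty (true  ∷ v) _ = zero , here
nonemptyᵇ⇒Nonempty (false ∷ v) t with nonemptyᵇ⇒Nonempty v t
... | x , x∈v = suc x , there x∈v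

Nonempty⇒nonemptyᵇ : ∀ {n} (v : Subset n) → Nonempty v → T (nonemptyᵇ v)
Nonempty⇒nonemptyᵇ (true  ∷ v) _                   = tt
Nonempty⇒nonemptyᵇ (false ∷ v) (suc x , there x∈v) = Nonempty⇒nonemptyᵇ v (x , x∈v)

-- The upper bound: the empty set plus an intersecting family of nonempty sets.
upper-bound : ∀ n m → m ≤ n → (F : Family (suc n)) → OneSimplexFree F → AllOfSizeAtMost m F →
  size F ≤ suc (star n m)
upper-bound n m m≤n (family xs unique) free small = begin
  length xs                                                   ≤⟨ length-≤-count xs unique ⟩
  count (_∈ᵇ xs)                                              ≡⟨ count-split (_∈ᵇ xs) nonemptyᵇ ⟩
  count φ + count φ∅                                          ≤⟨ +-mono-≤ (star-bound n m m≤n φ bounded intersecting) at-most-∅ ⟩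
  star n m + count {suc n} isEmpty                            ≡⟨ cong (star n m +_) (count-empty (suc n)) ⟩
  star n m + 1                                                ≡⟨ +-comm (star n m) 1 ⟩
  suc (star n m)                                              ∎
  where
  open ≤-Reasoning
  φ : Subset (suc n) → Bool
  φ v = v ∈ᵇ xs ∧ nonemptyᵇ v
  φ∅ : Subset (suc n) → Bool
  φ∅ v = v ∈ᵇ xs ∧ not (nonemptyᵇ v)
  at-most-∅ : count φ∅ ≤ count {suc n} isEmpty
  at-most-∅ = count-mono {φ = φ∅} {ψ = isEmpty} (λ v t → proj₂ (Equivalence.to T-∧ t))
  member : ∀ v → T (φ v) → v ∈ xs
  member v t = ∈ᵇ⇒∈ xs (proj₁ (Equivalence.to T-∧ t))
  bounded : Bounded m φ
  bounded v t = proj₂ (Equivalence.to T-∧ t) , All.lookup small (member v t)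
  intersecting : Intersecting φ
  intersecting u w tu tw with T? (meets u w)
  ... | yes uw  = uw
  ... | no  ¬uw = ⊥-elim (free (member u tu) (member w tw)
        (disjoint⇒Empty u w ¬uw , nonemptyᵇ⇒Nonempty u (proj₁ (bounded u tu)) , nonemptyᵇ⇒Nonempty w (proj₁ (bounded w tw))))

starFamily : ∀ {n} → ℕ → Subset (suc n) → Bool
starFamily m (false ∷ v) = isEmpty v
starFamily m (true  ∷ v) = suc ∣ v ∣ ≤ᵇ m

starFamily-size : ∀ {n} m (v : Subset (suc n)) → T (starFamily m v) → ∣ v ∣ ≤ m
starFamily-size m (false ∷ v) t = ≤-trans (≤-reflexive (isEmpty-size v t)) z≤n
starFamily-size m (true  ∷ v) t = ≤ᵇ⇒≤ _ m t

-- Its nonempty members all contain 0 (the empty member is excluded by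
-- abstracting over 'nonemptyᵇ w').
starFamily-centred : ∀ {n} m (v : Subset (suc n)) → T (starFamily m v) → Nonempty v → ∃ λ w → v ≡ true ∷ w
starFamily-centred m (true  ∷ w) _ _  = w , refl
starFamily-centred m (false ∷ w) t ne with nonemptyᵇ w | Nonempty⇒nonemptyᵇ (false ∷ w) ne
... | true | _ = ⊥-elim t

initial : ∀ {n} j → j ≤ n → Subset n
initial zero    _         = ∅
initial (suc j) (s≤s j≤n) = true ∷ initial j j≤n

size-initial : ∀ {n} j (j≤n : j ≤ n) → ∣ initial j j≤n ∣ ≡ j
size-initial {n} zero    _         = ∣⊥∣≡0 n
size-initial     (suc j) (s≤s j≤n) = cong suc (size-initial j j≤n)

starFamily-initial : ∀ {n} m (m≤n : m ≤ suc n) → T (starFamily m (initial m m≤n))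
starFamily-initial {n} zero    _         = isEmpty-∅ n
starFamily-initial     (suc j) (s≤s j≤n) = ≤⇒≤ᵇ (s≤s (≤-reflexive (size-initial j j≤n)))

star-family : ∀ n m → m ≤ n → Σ (Family (suc n)) λ F →
  OneSimplexFree F × AllOfSizeAtMost m F × HasMemberOfSize m F × size F ≡ suc (star n m)
star-family n m m≤n = F , free , small , large , size-F
  where
  ψ : Subset (suc n) → Bool
  ψ = starFamily m
  F : Family (suc n)
  F = family (enumerate ψ) (enumerate-unique ψ)
  free : OneSimplexFree F
  free {A} {B} A∈ B∈ (disjoint , neA , neB)
    with starFamily-centred m A (enumerate-sound ψ A∈) neA | starFamily-centred m B (enumerate-sound ψ B∈) neB
  ... | _ , refl | _ , refl = disjoint (zero , here)
  small : AllOfSizeAtMost m F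
  small = All.tabulate (λ {v} v∈ → starFamily-size m v (enumerate-sound ψ v∈))
  large : HasMemberOfSize m F
  large = Any-map (λ { refl → size-initial m (m≤n⇒m≤1+n m≤n) })
                  (enumerate-complete ψ (initial m _) (starFamily-initial m (m≤n⇒m≤1+n m≤n)))
  size-F : size F ≡ suc (star n m)
  size-F = trans (length-enumerate ψ) (cong (_+ star n m) (count-empty n))

-- The closed formula.

count-size : ∀ n j → count {n} (λ v → ∣ v ∣ ≡ᵇ j) ≡ n C j
count-size zero    zero    = refl
count-size zero    (suc j) = refl
count-size (suc n) zero    = cong₂ _+_ (count-size n zero) (count-none {n} (λ v → suc ∣ v ∣ ≡ᵇ zero) (λ v ()))
count-size (suc n) (suc j) = trans (cong₂ _+_ (count-size n (suc j)) (count-size n j))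
  (trans (+-comm (n C suc j) (n C j)) (nCk+nC[k+1]≡[n+1]C[k+1] n j))

<ᵇ-split : ∀ a j → 𝟙 (a <ᵇ suc j) ≡ 𝟙 (a <ᵇ j) + 𝟙 (a ≡ᵇ j)
<ᵇ-split zero    zero    = refl
<ᵇ-split zero    (suc j) = refl
<ᵇ-split (suc a) zero    = refl
<ᵇ-split (suc a) (suc j) = <ᵇ-split a j

sumBinom-count : ∀ n j → sumBinom n (suc j) ≡ count {n} (λ v → inRange 0 j ∣ v ∣)
sumBinom-count n zero    = sym (count-none {n} (λ v → inRange 0 0 ∣ v ∣)
  (λ v t → let (0<a , a≤0) = inRange-elim ∣ v ∣ t in <⇒≱ 0<a a≤0))
sumBinom-count n (suc j) = begin
  sumBinom n (suc j) + n C suc j                                      ≡⟨ cong₂ _+_ (sumBinom-count n j) (sym (count-size n (suc j))) ⟩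
  count {n} (λ v → inRange 0 j ∣ v ∣) + count {n} (λ v → ∣ v ∣ ≡ᵇ suc j)    ≡⟨ ∑-+ {n} (λ v → 𝟙 (inRange 0 j ∣ v ∣)) (λ v → 𝟙 (∣ v ∣ ≡ᵇ suc j)) ⟨
  ∑ {n} (λ v → 𝟙 (inRange 0 j ∣ v ∣) + 𝟙 (∣ v ∣ ≡ᵇ suc j))               ≡⟨ ∑-cong {n} (λ v → extend ∣ v ∣) ⟩
  count {n} (λ v → inRange 0 (suc j) ∣ v ∣)                               ∎
  where
  open ≡-Reasoning
  extend : ∀ a → 𝟙 (inRange 0 j a) + 𝟙 (a ≡ᵇ suc j) ≡ 𝟙 (inRange 0 (suc j) a)
  extend zero    = refl
  extend (suc a) = sym (<ᵇ-split a j)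

count-full : ∀ n → count {n} (λ v → n <ᵇ suc ∣ v ∣) ≡ 1
count-full zero    = refl
count-full (suc n) = cong₂ _+_
  (count-none (λ v → n <ᵇ ∣ v ∣) (λ v t → ≤⇒≯ (∣p∣≤n v) (<ᵇ⇒< n ∣ v ∣ t)))
  (count-full n)

size-trichotomy : ∀ {n m k} a b → a + b ≡ n → m + k ≡ n →
  𝟙 (suc a ≤ᵇ m) + 𝟙 (n <ᵇ suc a) + 𝟙 (inRange 0 k b) ≡ 1
size-trichotomy {n} {m} {k} a b a+b≡n m+k≡n
  with suc a ≤ᵇ m | ≤ᵇ-reflects-≤ (suc a) m | n <ᵇ suc a | <ᵇ-reflects-< n (suc a)
... | true  | ofʸ a<m  | true  | ofʸ n≤a = ⊥-elim (<⇒≱ (≤-trans a<m (subst (m ≤_) m+k≡n (m≤m+n m k))) (≤-pred n≤a))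
... | true  | ofʸ a<m  | false | _       = cong suc (𝟙-¬T (λ t → <⇒≱ k<b (proj₂ (inRange-elim b t))))
  where
  k<b : k < b
  k<b = +-cancelˡ-< m k b (subst (_< m + b) (trans a+b≡n (sym m+k≡n)) (+-monoˡ-< b a<m))
... | false | _        | true  | ofʸ n≤a = cong suc (𝟙-¬T (λ t → <⇒≱ (proj₁ (inRange-elim b t)) b≤0))
  where
  b≤0 : b ≤ 0
  b≤0 = +-cancelˡ-≤ a b 0 (subst (a + b ≤_) (sym (+-identityʳ a)) (subst (_≤ a) (sym a+b≡n) (≤-pred n≤a)))
... | false | ofⁿ a≮m  | false | ofⁿ n≰a = 𝟙-T (inRange-intro 0<b b≤k)
  where
  0<b : 0 < b
  0<b = +-cancelˡ-< a 0 b (subst (_< a + b) (sym (+-identityʳ a)) (subst (a <_) (sym a+b≡n) (≮⇒≥ n≰a)))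
  b≤k : b ≤ k
  b≤k = +-cancelˡ-≤ m b k (subst (m + b ≤_) (trans a+b≡n (sym m+k≡n)) (+-monoˡ-≤ b (≮⇒≥ a≮m)))

-- With m = n - k: 2^n ∸ Σ_{j=1}^{k} C(n, j) = 1 + star n m, by sorting the
-- subsets of an n-set into those of size < m, the whole set, and those whose
-- complement has size in (0, k].
formula-star : ∀ n k → k ≤ n → formula (suc n) (suc k) ≡ suc (star n (n ∸ k))
formula-star n k k≤n = begin
  2 ^ n ∸ S                  ≡⟨ cong (_∸ S) partition ⟩
  (star n m + 1) + S ∸ S     ≡⟨ m+n∸n≡m (star n m + 1) S ⟩
  star n m + 1               ≡⟨ +-comm (star n m) 1 ⟩
  suc (star n m)             ∎
  where
  open ≡-Reasoning
  m = n ∸ k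
  S = sumBinom n (suc k)
  f g h : Subset n → ℕ
  f v = 𝟙 (suc ∣ v ∣ ≤ᵇ m)
  g v = 𝟙 (n <ᵇ suc ∣ v ∣)
  h v = 𝟙 (inRange 0 k ∣ v ∣)
  partition : 2 ^ n ≡ (star n m + 1) + S
  partition = begin
    2 ^ n                           ≡⟨ trans (∑-const n 1) (*-identityʳ (2 ^ n)) ⟨
    ∑ {n} (λ _ → 1)                 ≡⟨ ∑-cong (λ v → size-trichotomy ∣ v ∣ ∣ ∁ v ∣ (size-∁ v) (m∸n+n≡m k≤n)) ⟨
    ∑ (λ v → f v + g v + h (∁ v))   ≡⟨ ∑-+ (λ v → f v + g v) (h ∘ ∁) ⟩
    ∑ (λ v → f v + g v) + ∑ (h ∘ ∁) ≡⟨ cong₂ _+_ (∑-+ f g) (∑-∁ h) ⟩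
    (∑ f + ∑ g) + ∑ h               ≡⟨ cong₂ _+_ (cong (star n m +_) (count-full n)) (sym (sumBinom-count n k)) ⟩
    (star n m + 1) + S              ∎

claim6 : (n k : ℕ) → 1 ≤ k → k ≤ n →
    IsMaxSize n (GAdmissible n k) (formula n k) × IsMaxSize n (FAdmissible n k) (formula n k)
claim6 zero    zero    () _
claim6 zero    (suc k) _  ()
claim6 (suc n) zero    () _
claim6 (suc n) (suc k) _  (s≤s k≤n) with star-family n (n ∸ k) (m∸n≤m n k)
... | F , free , small , large , size-F =
    ((F , ((free , small) , large) , attains) , λ G → upper G ∘ proj₁)
  , ((F , (free , small) , attains) , upper)
  where
  attains : size F ≡ formula (suc n) (suc k)
  attains = trans size-F (sym (formula-star n k k≤n))
  upper : ∀ G → FAdmissible (suc n) (suc k) G → size G ≤ formula (suc n) (suc k)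
  upper G (freeG , smallG) = subst (size G ≤_) (sym (formula-star n k k≤n))
    (upper-bound n (n ∸ k) (m∸n≤m n k) G freeG smallG)
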